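{- Let $n\geq 3$ and let $G$ be any graph in $XQ_n$. Let $\{u_1,u_2,\ldots,u_{n+1}\}$ be a set of $n+1$ distinct nodes of $G$ with $N_G(u_1)=\{u_2,u_3,\ldots,u_{n+1}\}$. Then there exist distinct nodes $v_2,v_3,\ldots,v_{n+1}$ in $V(G)-\{u_1,u_2,\ldots,u_{n+1}\}$ such that $\{u_i,v_i\}\in E(G)$ for every $2\leq i\leq n+1$.
   Context: Hypercube-like graphs: $XQ_1=\{K_2\}$, where $K_2$ is the complete graph on two nodes. For $n\geq 1$, if $G_0=(V_0,E_0)$ and $G_1=(V_1,E_1)$ are graphs in $XQ_n$ on disjoint node sets and $\phi:V_0\to V_1$ is any bijection, then the graph $G_0\oplus G_1$ with node set $V_0\cup V_1$ and edge set $E_0\cup E_1\cup\{\{v,\phi(v)\}\mid v\in V_0\}$ belongs to $XQ_{n+1}$; $XQ_{n+1}$ consists exactly of the graphs obtained in this way (for all choices of $G_0,G_1,\phi$). Every graph in $XQ_n$ is a simple $n$-regular graph on $2^n$ nodes. $N_G(u)$ denotes the set of neighbors of $u$ in $G$. -}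

module Defs where

open import Data.Nat using (ℕ; zero; suc)
open import Data.Bool using (Bool; true; false)
open import Data.Vec using (Vec; []; _∷_)
open import Data.Empty using (⊥)
open import Data.Unit using (⊤)
open import Relation.Binary.PropositionalEquality using (_≡_)
open import Function.Bundles using (_↔_; Inverse)

-- Since every graph in XQ_n has 2^n nodes and the node sets in the recursive
-- construction are arbitrary, every graph of XQ_n is isomorphic to one of the
-- graphs below (node set Bits n, with G0 on the nodes starting with false and
-- G1 on the nodes starting with true), and conversely.
Bits : ℕ → Set
Bits n = Vec Bool n

Adj : ℕ → Set₁
Adj n = Bits n → Bits n → Set

K2 : Adj 1
K2 (false ∷ []) (true ∷ [])  = ⊤
K2 (true ∷ [])  (false ∷ []) = ⊤
K2 _            _            = ⊥

_⊕[_]_ : ∀ {n} → Adj n → (Bits n ↔ Bits n) → Adj n → Adj (suc n)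
(E0 ⊕[ φ ] E1) (false ∷ x) (false ∷ y) = E0 x y
(E0 ⊕[ φ ] E1) (true ∷ x)  (true ∷ y)  = E1 x y
(E0 ⊕[ φ ] E1) (false ∷ x) (true ∷ y)  = y ≡ Inverse.to φ x
(E0 ⊕[ φ ] E1) (true ∷ x)  (false ∷ y) = x ≡ Inverse.to φ y

data XQ : (n : ℕ) → Adj n → Set₁ where
  xq-base : XQ 1 K2
  xq-step : ∀ {n} {E0 E1 : Adj n} → XQ n E0 → XQ n E1 →
            (φ : Bits n ↔ Bits n) → XQ (suc n) (E0 ⊕[ φ ] E1)

-- Write G = G0 ⊕ G1 with u₁ = (0,x) in G0 (the other case is symmetric). Pick a
-- neighbour w of φ(x) in G1. The cross neighbour (1,φx) of u₁ is sent to (1,w);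
-- a neighbour (0,y) is sent across to (1,φy), except for the at most one y with
-- φy = w, which is sent to (0,z) for a neighbour z ≠ x of y in G0. Since XQ
-- graphs are loopless and triangle-free, none of these nodes lies in N[u₁],
-- and injectivity of φ makes them distinct.
module Submission where

open import Defs
open import Data.Nat using (ℕ; suc; _≤_; s≤s)
open import Data.Fin using (Fin; zero; suc)
import Data.Fin.Properties as Fin
open import Data.Bool using (Bool; true; false)
import Data.Bool.Properties as Bool
open import Data.Vec using ([]; _∷_)
import Data.Vec.Properties as Vec
open import Data.Empty using (⊥; ⊥-elim)
open import Data.Unit using (tt)
open import Data.Sum using (_⊎_; inj₁; inj₂)
open import Data.Product using (Σ; ∃; _×_; _,_; proj₁; proj₂)
open import Relation.Nullary using (yes; no)
open import Relation.Binary.Definitions using (Irreflexive; DecidableEquality)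
open import Relation.Binary.PropositionalEquality
  using (_≡_; _≢_; refl; sym; trans; cong; subst)
open import Algebra.Definitions using (Involutive)
open import Function.Definitions using (Injective)
open import Function.Bundles using (_⇔_; _↔_; Inverse; Injection; Equivalence)
open import Function.Properties.Inverse using (↔-sym; ↔⇒↣)

_≟_ : ∀ {n} → DecidableEquality (Bits n)
_≟_ = Vec.≡-dec Bool._≟_

∷-injectiveʳ : ∀ {n} {a b : Bool} {x y : Bits n} → a ∷ x ≡ b ∷ y → x ≡ y
∷-injectiveʳ refl = refl

↔-injective : ∀ {a b} {A : Set a} {B : Set b} (φ : A ↔ B) → Injective _≡_ _≡_ (Inverse.to φ)
↔-injective φ = Injection.injective (↔⇒↣ φ)

involutive⇒injective : ∀ {a} {A : Set a} {f : A → A} →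
  Involutive _≡_ f → Injective _≡_ _≡_ f
involutive⇒injective {f = f} inv {x} {y} fx≡fy =
  trans (sym (inv x)) (trans (cong f fx≡fy) (inv y))

TriangleFree : ∀ {n} → Adj n → Set
TriangleFree E = ∀ a b c → E a b → E b c → E a c → ⊥

Serial : ∀ {n} → Adj n → Set
Serial E = ∀ a → ∃ (E a)

MinDegreeTwo : ∀ {n} → Adj n → Set
MinDegreeTwo E = ∀ a b → ∃ λ c → E a c × c ≢ b

module _ {n} {E0 E1 : Adj n} {φ : Bits n ↔ Bits n} where
  open Inverse φ using (to; from; strictlyInverseˡ)

  ⊕-irreflexive : Irreflexive _≡_ E0 → Irreflexive _≡_ E1 →
    Irreflexive _≡_ (E0 ⊕[ φ ] E1)
  ⊕-irreflexive irr₀ irr₁ {false ∷ x} refl = irr₀ refl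
  ⊕-irreflexive irr₀ irr₁ {true ∷ x}  refl = irr₁ refl

  -- A triangle meeting both halves uses two cross edges at one node, which
  -- injectivity of φ forces to be a loop inside one half.
  ⊕-triangleFree : Irreflexive _≡_ E0 → Irreflexive _≡_ E1 →
    TriangleFree E0 → TriangleFree E1 → TriangleFree (E0 ⊕[ φ ] E1)
  ⊕-triangleFree _ _ tf₀ _ (false ∷ a) (false ∷ b) (false ∷ c) = tf₀ a b c
  ⊕-triangleFree _ _ _ tf₁ (true ∷ a) (true ∷ b) (true ∷ c) = tf₁ a b c
  ⊕-triangleFree irr₀ _ _ _ (false ∷ a) (false ∷ b) (true ∷ c) ab bc ac =
    irr₀ (↔-injective φ (trans (sym ac) bc)) ab
  ⊕-triangleFree irr₀ _ _ _ (false ∷ a) (true ∷ b) (false ∷ c) ab bc ac =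
    irr₀ (↔-injective φ (trans (sym ab) bc)) ac
  ⊕-triangleFree _ irr₁ _ _ (false ∷ a) (true ∷ b) (true ∷ c) ab bc ac =
    irr₁ (trans ab (sym ac)) bc
  ⊕-triangleFree irr₀ _ _ _ (true ∷ a) (false ∷ b) (false ∷ c) ab bc ac =
    irr₀ (↔-injective φ (trans (sym ab) ac)) bc
  ⊕-triangleFree _ irr₁ _ _ (true ∷ a) (false ∷ b) (true ∷ c) ab bc ac =
    irr₁ (trans ab (sym bc)) ac
  ⊕-triangleFree _ irr₁ _ _ (true ∷ a) (true ∷ b) (false ∷ c) ab bc ac =
    irr₁ (trans ac (sym bc)) ab

  ⊕-serial : Serial (E0 ⊕[ φ ] E1)
  ⊕-serial (false ∷ x) = true ∷ to x , refl
  ⊕-serial (true ∷ x)  = false ∷ from x , sym (strictlyInverseˡ x)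

  ⊕-minDegreeTwo : Serial E0 → Serial E1 → MinDegreeTwo (E0 ⊕[ φ ] E1)
  ⊕-minDegreeTwo ser₀ ser₁ (false ∷ x) b with b ≟ (true ∷ to x)
  ... | yes refl = let (y , xy) = ser₀ x in false ∷ y , xy , λ ()
  ... | no b≢    = true ∷ to x , refl , λ eq → b≢ (sym eq)
  ⊕-minDegreeTwo ser₀ ser₁ (true ∷ x) b with b ≟ (false ∷ from x)
  ... | yes refl = let (y , xy) = ser₁ x in true ∷ y , xy , λ ()
  ... | no b≢    = false ∷ from x , sym (strictlyInverseˡ x) , λ eq → b≢ (sym eq)

XQ-irreflexive : ∀ {n E} → XQ n E → Irreflexive _≡_ E
XQ-irreflexive xq-base {false ∷ []} refl ()
XQ-irreflexive xq-base {true ∷ []}  refl ()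
XQ-irreflexive (xq-step g₀ g₁ φ) = ⊕-irreflexive (XQ-irreflexive g₀) (XQ-irreflexive g₁)

K2-triangleFree : TriangleFree K2
K2-triangleFree (false ∷ []) (true ∷ []) (false ∷ []) _ _ ()
K2-triangleFree (true ∷ []) (false ∷ []) (true ∷ []) _ _ ()

XQ-triangleFree : ∀ {n E} → XQ n E → TriangleFree E
XQ-triangleFree xq-base = K2-triangleFree
XQ-triangleFree (xq-step g₀ g₁ φ) =
  ⊕-triangleFree (XQ-irreflexive g₀) (XQ-irreflexive g₁)
                 (XQ-triangleFree g₀) (XQ-triangleFree g₁)

XQ-serial : ∀ {n E} → XQ n E → Serial E
XQ-serial xq-base (false ∷ []) = true ∷ [] , tt
XQ-serial xq-base (true ∷ [])  = false ∷ [] , tt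
XQ-serial (xq-step g₀ g₁ φ) = ⊕-serial

XQ-minDegreeTwo : ∀ {n E} → 2 ≤ n → XQ n E → MinDegreeTwo E
XQ-minDegreeTwo (s≤s ()) xq-base
XQ-minDegreeTwo _ (xq-step g₀ g₁ φ) = ⊕-minDegreeTwo (XQ-serial g₀) (XQ-serial g₁)

ClosedNeighbour : ∀ {n} → Adj n → Bits n → Bits n → Set
ClosedNeighbour E c b = b ≡ c ⊎ E c b

record Escape {n} (E : Adj n) (c : Bits n) : Set where
  field
    escape           : Bits n → Bits n
    escape-edge      : ∀ {a} → E c a → E a (escape a)
    escape-outside   : ∀ {a b} → E c a → ClosedNeighbour E c b → escape a ≢ b
    escape-injective : ∀ {a a′} → E c a → E c a′ → escape a ≡ escape a′ → a ≡ a′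

escape⇒matching : ∀ {n k} {E : Adj n} (u : Fin (suc k) → Bits n) →
  Injective _≡_ _≡_ u → (∀ i → E (u zero) (u (suc i))) → Escape E (u zero) →
  Σ (Fin k → Bits n) (λ v →
    Injective _≡_ _≡_ v × (∀ i j → v i ≢ u j) × (∀ i → E (u (suc i)) (v i)))
escape⇒matching {n} {k} u u-inj leaf esc = v , v-injective , v-outside , λ i → escape-edge (leaf i)
  where
  open Escape esc
  v : Fin k → Bits n
  v i = escape (u (suc i))
  v-injective : Injective _≡_ _≡_ v
  v-injective {i} {j} eq = Fin.suc-injective (u-inj (escape-injective (leaf i) (leaf j) eq))
  v-outside : ∀ i j → v i ≢ u j
  v-outside i zero    = escape-outside (leaf i) (inj₁ refl)
  v-outside i (suc j) = escape-outside (leaf i) (inj₂ (leaf j))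

escape-transport : ∀ {n} {E E′ : Adj n} (f : Bits n → Bits n) → Involutive _≡_ f →
  (∀ {a b} → E a b → E′ (f a) (f b)) → (∀ {a b} → E′ a b → E (f a) (f b)) →
  ∀ {c} → Escape E′ (f c) → Escape E c
escape-transport {E = E} {E′} f inv hom hom⁻ {c} esc = record
  { escape           = λ a → f (escape (f a))
  ; escape-edge      = λ {a} ca → subst (λ a′ → E a′ (f (escape (f a)))) (inv a)
                                        (hom⁻ (escape-edge (hom ca)))
  ; escape-outside   = λ {a} {b} ca cb eq →
      escape-outside (hom ca) (closed cb) (trans (sym (inv (escape (f a)))) (cong f eq))
  ; escape-injective = λ ca ca′ eq →
      f-injective (escape-injective (hom ca) (hom ca′) (f-injective eq))
  }
  where
  open Escape esc
  f-injective : Injective _≡_ _≡_ f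
  f-injective = involutive⇒injective inv
  closed : ∀ {b} → ClosedNeighbour E c b → ClosedNeighbour E′ (f c) (f b)
  closed (inj₁ refl) = inj₁ refl
  closed (inj₂ cb)   = inj₂ (hom cb)

module _ {n} {E0 E1 : Adj n} (φ : Bits n ↔ Bits n)
         (irr₀ : Irreflexive _≡_ E0) (tf₀ : TriangleFree E0) (deg₀ : MinDegreeTwo E0)
         (irr₁ : Irreflexive _≡_ E1) (ser₁ : Serial E1) (x : Bits n) where
  open Inverse φ using (to)
  private
    E : Adj (suc n)
    E = E0 ⊕[ φ ] E1

    w : Bits n
    w = proj₁ (ser₁ (to x))

    φx-w : E1 (to x) w
    φx-w = proj₂ (ser₁ (to x))

    z : Bits n → Bits n
    z y = proj₁ (deg₀ y x)

    y-z : ∀ y → E0 y (z y)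
    y-z y = proj₁ (proj₂ (deg₀ y x))

    z≢x : ∀ y → z y ≢ x
    z≢x y = proj₂ (proj₂ (deg₀ y x))

    escape : Bits (suc n) → Bits (suc n)
    escape (true ∷ _) = true ∷ w
    escape (false ∷ y) with to y ≟ w
    ... | yes _ = false ∷ z y
    ... | no _  = true ∷ to y

    escape-edge : ∀ {a} → E (false ∷ x) a → E a (escape a)
    escape-edge {true ∷ _} refl = φx-w
    escape-edge {false ∷ y} _ with to y ≟ w
    ... | yes _ = y-z y
    ... | no _  = refl

    escape-outside : ∀ {a b} → E (false ∷ x) a → ClosedNeighbour E (false ∷ x) b →
      escape a ≢ b
    escape-outside {true ∷ _} _ (inj₁ refl) ()
    escape-outside {true ∷ _} refl (inj₂ w≡φx) refl = irr₁ (sym w≡φx) φx-w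
    escape-outside {false ∷ y} x-y b∈N[x] with to y ≟ w | b∈N[x]
    ... | yes _ | inj₁ refl  = λ eq → z≢x y (∷-injectiveʳ eq)
    ... | yes _ | inj₂ x-z   = λ { refl → tf₀ x y (z y) x-y (y-z y) x-z }
    ... | no _  | inj₁ refl  = λ ()
    ... | no _  | inj₂ φy≡φx = λ { refl → irr₀ (↔-injective φ (sym φy≡φx)) x-y }

    escape-injective : ∀ {a a′} → E (false ∷ x) a → E (false ∷ x) a′ →
      escape a ≡ escape a′ → a ≡ a′
    escape-injective {true ∷ _} {true ∷ _} refl refl _ = refl
    escape-injective {true ∷ _} {false ∷ y′} _ _ with to y′ ≟ w
    ... | yes _    = λ ()
    ... | no φy′≢w = λ eq → ⊥-elim (φy′≢w (sym (∷-injectiveʳ eq)))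
    escape-injective {false ∷ y} {true ∷ _} _ _ with to y ≟ w
    ... | yes _   = λ ()
    ... | no φy≢w = λ eq → ⊥-elim (φy≢w (∷-injectiveʳ eq))
    escape-injective {false ∷ y} {false ∷ y′} _ _ with to y ≟ w | to y′ ≟ w
    ... | yes φy≡w | yes φy′≡w = λ _ → cong (false ∷_) (↔-injective φ (trans φy≡w (sym φy′≡w)))
    ... | yes _    | no _      = λ ()
    ... | no _     | yes _     = λ ()
    ... | no _     | no _      = λ eq → cong (false ∷_) (↔-injective φ (∷-injectiveʳ eq))

  ⊕-escapeˡ : Escape (E0 ⊕[ φ ] E1) (false ∷ x)
  ⊕-escapeˡ = record
    { escape           = escape
    ; escape-edge      = λ {a} → escape-edge {a}
    ; escape-outside   = λ {a} → escape-outside {a}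
    ; escape-injective = λ {a} {a′} → escape-injective {a} {a′}
    }

swap : ∀ {n} → Bits (suc n) → Bits (suc n)
swap (false ∷ x) = true ∷ x
swap (true ∷ x)  = false ∷ x

swap-involutive : ∀ {n} → Involutive _≡_ (swap {n})
swap-involutive (false ∷ x) = refl
swap-involutive (true ∷ x)  = refl

module _ {n} {E0 E1 : Adj n} {φ : Bits n ↔ Bits n} where
  open Inverse φ using (inverseˡ; inverseʳ)

  swap-homo : ∀ {a b} → (E0 ⊕[ φ ] E1) a b → (E1 ⊕[ ↔-sym φ ] E0) (swap a) (swap b)
  swap-homo {false ∷ _} {false ∷ _} e = e
  swap-homo {true ∷ _}  {true ∷ _}  e = e
  swap-homo {false ∷ _} {true ∷ _}  e = sym (inverseʳ e)
  swap-homo {true ∷ _}  {false ∷ _} e = sym (inverseʳ e)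

  swap-homo⁻ : ∀ {a b} → (E1 ⊕[ ↔-sym φ ] E0) a b → (E0 ⊕[ φ ] E1) (swap a) (swap b)
  swap-homo⁻ {false ∷ _} {false ∷ _} e = e
  swap-homo⁻ {true ∷ _}  {true ∷ _}  e = e
  swap-homo⁻ {false ∷ _} {true ∷ _}  e = sym (inverseˡ e)
  swap-homo⁻ {true ∷ _}  {false ∷ _} e = sym (inverseˡ e)

⊕-escape : ∀ {n} {E0 E1 : Adj n} → 2 ≤ n → XQ n E0 → XQ n E1 →
  (φ : Bits n ↔ Bits n) → ∀ c → Escape (E0 ⊕[ φ ] E1) c
⊕-escape n≥2 g₀ g₁ φ (false ∷ x) =
  ⊕-escapeˡ φ (XQ-irreflexive g₀) (XQ-triangleFree g₀) (XQ-minDegreeTwo n≥2 g₀)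
              (XQ-irreflexive g₁) (XQ-serial g₁) x
⊕-escape n≥2 g₀ g₁ φ (true ∷ x) =
  escape-transport swap swap-involutive
    (λ {a} {b} → swap-homo {a = a} {b}) (λ {a} {b} → swap-homo⁻ {a = a} {b})
    (⊕-escape n≥2 g₁ g₀ (↔-sym φ) (false ∷ x))

lemma3p4 : (n : ℕ) → 3 ≤ n → (E : Adj n) → XQ n E →
    (u : Fin (suc n) → Bits n) → Injective _≡_ _≡_ u →
    (∀ w → E (u zero) w ⇔ ∃ (λ i → w ≡ u (suc i))) →
    Σ (Fin n → Bits n) (λ v →
      Injective _≡_ _≡_ v ×
      (∀ i j → v i ≢ u j) ×
      (∀ i → E (u (suc i)) (v i)))
lemma3p4 .1 (s≤s ()) _ xq-base _ _ _
lemma3p4 (suc n) (s≤s n≥2) E (xq-step g₀ g₁ φ) u u-injective N[u₀] =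
  escape⇒matching u u-injective leaf (⊕-escape n≥2 g₀ g₁ φ (u zero))
  where
  leaf : ∀ i → E (u zero) (u (suc i))
  leaf i = Equivalence.from (N[u₀] (u (suc i))) (i , refl)
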